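{- Let $G=(V,E)$ be an unweighted undirected graph with no isolated nodes and $k$ a positive integer. Let $O$ be an optimal solution of group-harmonic maximization (i.e., $|O|=k$ and $\mathrm{GH}(O)$ is maximum among $k$-subsets of $V$), and let $S_i$ be the set computed by the greedy algorithm after iteration $i$, with $S_0=\emptyset$. Then for each $i=1,\dots,k$, \[\mathrm{GH}(S_i)-\mathrm{GH}(S_{i-1})\ \ge\ \frac{1}{k}\big(\mathrm{GH}(O)-\mathrm{GH}(S_{i-1})\big)-1.\]
   Context: $\mathrm{dist}$ is the hop distance, $\mathrm{dist}(S,v):=\min_{u\in S}\mathrm{dist}(u,v)$, $\mathrm{GH}(S):=\sum_{v\in V\setminus S}\frac{1}{\mathrm{dist}(S,v)}$ (term $0$ if unreachable). Greedy algorithm: start with $S=\emptyset$; while $|S|<k$, add a vertex $v\in V\setminus S$ maximizing $\mathrm{GH}(S\cup\{v\})-\mathrm{GH}(S)$. -}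

module Defs where

open import Data.Bool using (Bool; true; false; _∧_; _∨_; if_then_else_)
open import Data.Nat using (ℕ; zero; suc; _<ᵇ_)
open import Data.Fin using (Fin; toℕ; _≟_)
open import Data.Fin.Subset using (Subset; ⊥; _∪_; ⁅_⁆)
open import Data.Vec using (Vec; lookup; tabulate)
open import Data.List using (List; foldr; map)
open import Data.Bool.ListAction using () renaming (any to anyL)
open import Data.Maybe using (Maybe; just; nothing)
open import Data.Product using (∃)
open import Data.Integer using (+_)
open import Data.Rational using (ℚ; 0ℚ; _+_; _/_)
open import Relation.Nullary.Decidable using (⌊_⌋)
open import Relation.Binary.PropositionalEquality using (_≡_)
import Data.List as L

Graph : ℕ → Set
Graph n = Fin n → Fin n → Bool

record IsUndirected {n : ℕ} (G : Graph n) : Set where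
  field
    sym     : ∀ u v → G u v ≡ G v u
    loopless : ∀ v → G v v ≡ false

NoIsolated : {n : ℕ} → Graph n → Set
NoIsolated {n} G = ∀ (v : Fin n) → ∃ λ (u : Fin n) → G v u ≡ true

vertices : (n : ℕ) → List (Fin n)
vertices n = L.allFin n

step : {n : ℕ} → Graph n → Subset n → Subset n
step {n} G S = tabulate λ v → lookup S v ∨ anyL (λ u → lookup S u ∧ G u v) (vertices n)

ball : {n : ℕ} → Graph n → Subset n → ℕ → Subset n
ball G S zero    = S
ball G S (suc d) = step G (ball G S d)

search : {n : ℕ} → Graph n → Subset n → Fin n → ℕ → ℕ → Maybe ℕ
search G S v d zero       = if lookup (ball G S d) v then just d else nothing
search G S v d (suc fuel) = if lookup (ball G S d) v then just d else search G S v (suc d) fuel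

-- hop distance dist(S,v) = min over u ∈ S of the shortest-path length
-- from u to v; nothing if v is unreachable from S.
-- (Every shortest path has length ≤ n, so searching d = 0..n suffices.)
dist : {n : ℕ} → Graph n → Subset n → Fin n → Maybe ℕ
dist {n} G S v = search G S v 0 n

sumℚ : List ℚ → ℚ
sumℚ = foldr _+_ 0ℚ

term : {n : ℕ} → Graph n → Subset n → Fin n → ℚ
term G S v with lookup S v | dist G S v
... | true  | _            = 0ℚ
... | false | nothing      = 0ℚ
... | false | just zero    = 0ℚ
... | false | just (suc d) = + 1 / suc d

GH : {n : ℕ} → Graph n → Subset n → ℚ
GH {n} G S = sumℚ (map (term G S) (vertices n))

prefix : {n k : ℕ} → (Fin k → Fin n) → ℕ → Subset n
prefix {n} {k} vs m =
  tabulate λ v → anyL (λ j → (toℕ j <ᵇ m) ∧ ⌊ vs j ≟ v ⌋) (vertices k)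

module Submission where

-- Write closeness d = 1/max(1,d), with 0 for unreachable vertices, and
-- coverage X = Σ_v closeness (dist(X,v)).  Members of X contribute 1, so
-- coverage X = GH(X) + |X|.  The ball of radius d around A ∪ B is the union of
-- the balls around A and B, hence dist(A ∪ B, v) = min(dist(A,v), dist(B,v))
-- and closeness to a union is a pointwise maximum; this makes coverage
-- monotone and submodular.  At S = S_{i-1} the greedy choice bounds every
-- marginal gain of coverage by g + 1, where g = GH(S_i) − GH(S_{i-1}), so
-- submodularity gives coverage O ≤ coverage (S ∪ O) ≤ coverage S + k (g + 1),
-- i.e. GH(O) + k ≤ GH(S) + |S| + k (g + 1); with |S| = i − 1 ≤ k this is the claim.

open import Defs
open import Algebra.Bundles using (CommutativeMonoid; CommutativeRing)
open import Data.Bool using (Bool; true; false; _∧_; _∨_; if_then_else_)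
open import Data.Bool.Properties using (∨-identityʳ; ∧-distribʳ-∨; ∨-commutativeMonoid)
open import Data.Bool.ListAction using (any; or)
open import Data.Fin using (Fin; zero; suc; toℕ; fromℕ<; _≟_)
open import Data.Fin.Properties using (toℕ-fromℕ<; toℕ≤n)
open import Data.Fin.Subset using (Subset; ⊥; ⁅_⁆; _∪_; ⋃; ∣_∣; _∈_; _∉_; inside; outside)
open import Data.Fin.Subset.Properties using (_∈?_; ∪-identityˡ; ∪-identityʳ; ∪-assoc; ∣⊥∣≡0)
open import Data.Integer as ℤ using (+_)
import Data.Integer.Properties as ℤ
import Data.Integer.Solver as ℤ-Solver
open import Data.List using (List; []; _∷_; map; length; allFin)
import Data.List as List
open import Data.List.Properties using (map-tabulate; map-cong; length-map)
open import Data.Maybe using (Maybe; just; nothing)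
open import Data.Maybe.Properties using (just-injective)
open import Data.Nat as ℕ using (ℕ; zero; suc; NonZero; z≤n; s≤s; _<ᵇ_)
import Data.Nat.Properties as ℕ
open import Data.Rational using (ℚ; 0ℚ; 1ℚ; _+_; _-_; -_; _*_; _/_; _≤_; _⊔_; toℚᵘ)
open import Data.Rational.Properties
  using (≤-refl; ≤-reflexive; ≤-trans; module ≤-Reasoning; +-comm; +-identityˡ; +-identityʳ;
         +-mono-≤; +-monoˡ-≤; +-monoʳ-≤; *-identityˡ; *-monoˡ-≤-nonNeg;
         ⊔-idem; ⊔-sel; ⊔-lub; ⊔-mono-≤; p≤p⊔q; p≤q⊔p; p≤q⇒p⊔q≡q; p≥q⇒p⊔q≡p;
         nonNegative⁻¹; normalize-nonNeg; toℚᵘ-injective; toℚᵘ-cancel-≤; toℚᵘ-fromℚᵘ; toℚᵘ-homo-+;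
         +-0-commutativeMonoid; +-*-commutativeRing)
import Data.Rational.Solver as ℚ-Solver
import Data.Rational.Unnormalised as ℚᵘ
import Data.Rational.Unnormalised.Properties as ℚᵘ
open import Data.Sum using (inj₁; inj₂)
open import Data.Vec using (Vec; []; _∷_; lookup; tabulate; here; there)
open import Data.Vec.Properties
  using (lookup-zipWith; lookup-replicate; lookup∘tabulate; tabulate∘lookup; tabulate-cong)
open import Function using (_∘_; id; case_of_)
open import Relation.Binary.PropositionalEquality
open import Relation.Nullary using (contradiction; yes; no)
open import Relation.Nullary.Decidable using (⌊_⌋)
open import Algebra.Properties.CommutativeSemigroup
  (CommutativeMonoid.commutativeSemigroup ∨-commutativeMonoid) using (interchange)
open import Algebra.Properties.CommutativeMonoid.Sum +-0-commutativeMonoid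
  using (sum; ∑-distrib-+; sum-cong-≗)
open import Algebra.Properties.Semiring.Mult (CommutativeRing.semiring +-*-commutativeRing)
  using (_×_; ×-comm-*; ×-assoc-*)

lookup-ext : ∀ {a} {A : Set a} {n} {xs ys : Vec A n} → (∀ i → lookup xs i ≡ lookup ys i) → xs ≡ ys
lookup-ext {xs = xs} {ys} eq = begin
  xs                   ≡⟨ tabulate∘lookup xs ⟨
  tabulate (lookup xs) ≡⟨ tabulate-cong eq ⟩
  tabulate (lookup ys) ≡⟨ tabulate∘lookup ys ⟩
  ys                   ∎
  where open ≡-Reasoning

lookup-∪ : ∀ {n} (p q : Subset n) i → lookup (p ∪ q) i ≡ lookup p i ∨ lookup q i
lookup-∪ p q i = lookup-zipWith _∨_ i p q

lookup-⁅⁆ : ∀ {n} (x y : Fin n) → lookup ⁅ x ⁆ y ≡ ⌊ x ≟ y ⌋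
lookup-⁅⁆ zero    zero    = refl
lookup-⁅⁆ zero    (suc y) = lookup-replicate y outside
lookup-⁅⁆ (suc x) zero    = refl
-- ⌊ suc x ≟ suc y ⌋ only reduces once x ≟ y has been evaluated.
lookup-⁅⁆ (suc x) (suc y) with x ≟ y | lookup-⁅⁆ x y
... | yes _ | eq = eq
... | no _  | eq = eq

x∈p⇒p∪⁅x⁆≡p : ∀ {n} {p : Subset n} {x} → x ∈ p → p ∪ ⁅ x ⁆ ≡ p
x∈p⇒p∪⁅x⁆≡p {p = inside ∷ p} here        = cong (inside ∷_) (∪-identityʳ p)
x∈p⇒p∪⁅x⁆≡p {p = s ∷ p}      (there x∈p) = cong₂ _∷_ (∨-identityʳ s) (x∈p⇒p∪⁅x⁆≡p x∈p)

x∉p⇒∣p∪⁅x⁆∣≡1+∣p∣ : ∀ {n} {p : Subset n} {x} → x ∉ p → ∣ p ∪ ⁅ x ⁆ ∣ ≡ suc ∣ p ∣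
x∉p⇒∣p∪⁅x⁆∣≡1+∣p∣ {p = inside  ∷ p} {zero}  x∉p = contradiction here x∉p
x∉p⇒∣p∪⁅x⁆∣≡1+∣p∣ {p = outside ∷ p} {zero}  _   = cong (suc ∘ ∣_∣) (∪-identityʳ p)
x∉p⇒∣p∪⁅x⁆∣≡1+∣p∣ {p = inside  ∷ p} {suc x} x∉p = cong suc (x∉p⇒∣p∪⁅x⁆∣≡1+∣p∣ (x∉p ∘ there))
x∉p⇒∣p∪⁅x⁆∣≡1+∣p∣ {p = outside ∷ p} {suc x} x∉p = x∉p⇒∣p∪⁅x⁆∣≡1+∣p∣ (x∉p ∘ there)

elements : ∀ {n} → Subset n → List (Fin n)
elements []            = []
elements (inside  ∷ p) = zero ∷ map suc (elements p)
elements (outside ∷ p) = map suc (elements p)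

length-elements : ∀ {n} (p : Subset n) → length (elements p) ≡ ∣ p ∣
length-elements []            = refl
length-elements (inside  ∷ p) = cong suc (trans (length-map suc (elements p)) (length-elements p))
length-elements (outside ∷ p) = trans (length-map suc (elements p)) (length-elements p)

⋃-map-suc : ∀ {n} (xs : List (Fin n)) → ⋃ (map ⁅_⁆ (map suc xs)) ≡ outside ∷ ⋃ (map ⁅_⁆ xs)
⋃-map-suc []       = refl
⋃-map-suc (x ∷ xs) = cong (⁅ suc x ⁆ ∪_) (⋃-map-suc xs)

⋃-elements : ∀ {n} (p : Subset n) → ⋃ (map ⁅_⁆ (elements p)) ≡ p
⋃-elements []            = refl
⋃-elements (inside  ∷ p) = trans (cong (⁅ zero ⁆ ∪_) (⋃-map-suc (elements p)))
                                 (cong (inside ∷_) (trans (∪-identityˡ _) (⋃-elements p)))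
⋃-elements (outside ∷ p) = trans (⋃-map-suc (elements p)) (cong (outside ∷_) (⋃-elements p))

+-cancelʳ-≤ : ∀ r {p q} → p + r ≤ q + r → p ≤ q
+-cancelʳ-≤ r {p} {q} p+r≤q+r = begin
  p             ≡⟨ solve 2 (λ p r → p := (p :+ r) :- r) refl p r ⟩
  (p + r) - r   ≤⟨ +-monoˡ-≤ (- r) p+r≤q+r ⟩
  (q + r) - r   ≡⟨ solve 2 (λ q r → (q :+ r) :- r := q) refl q r ⟩
  q             ∎
  where
  open ≤-Reasoning
  open ℚ-Solver.+-*-Solver

⊔+≤+ : ∀ {x a b} → x ≤ a → x ≤ b → a ⊔ b + x ≤ a + b
⊔+≤+ {x} {a} {b} x≤a x≤b with ⊔-sel a b
... | inj₁ a⊔b≡a = subst (λ m → m + x ≤ a + b) (sym a⊔b≡a) (+-monoʳ-≤ a x≤b)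
... | inj₂ a⊔b≡b = subst₂ (λ m c → m + x ≤ c) (sym a⊔b≡b) (+-comm b a) (+-monoʳ-≤ b x≤a)

⊔-submodular : ∀ x y z → x ⊔ (y ⊔ z) + x ≤ (x ⊔ y) + (x ⊔ z)
⊔-submodular x y z = ≤-trans
  (+-monoˡ-≤ x (⊔-lub (≤-trans (p≤p⊔q x y) (p≤p⊔q _ _)) (⊔-mono-≤ (p≤q⊔p x y) (p≤q⊔p x z))))
  (⊔+≤+ (p≤p⊔q x y) (p≤p⊔q x z))

×-nonNeg : ∀ m {x} → 0ℚ ≤ x → 0ℚ ≤ m × x
×-nonNeg zero    _   = ≤-refl
×-nonNeg (suc m) 0≤x = +-mono-≤ 0≤x (×-nonNeg m 0≤x)

×-monoˡ-≤ : ∀ {m n x} → 0ℚ ≤ x → m ℕ.≤ n → m × x ≤ n × x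
×-monoˡ-≤ {n = n} 0≤x z≤n       = ×-nonNeg n 0≤x
×-monoˡ-≤ {x = x} 0≤x (s≤s m≤n) = +-monoʳ-≤ x (×-monoˡ-≤ 0≤x m≤n)

toℚᵘ[1/n] : ∀ d → toℚᵘ (+ 1 / suc d) ℚᵘ.≃ ℚᵘ.mkℚᵘ (+ 1) d
toℚᵘ[1/n] d = toℚᵘ-fromℚᵘ (ℚᵘ.mkℚᵘ (+ 1) d)

toℚᵘ-×[1/n] : ∀ m d → toℚᵘ (m × (+ 1 / suc d)) ℚᵘ.≃ ℚᵘ.mkℚᵘ (+ m) d
toℚᵘ-×[1/n] zero    d = ℚᵘ.*≡* refl
toℚᵘ-×[1/n] (suc m) d = ℚᵘ.≃-trans (toℚᵘ-homo-+ (+ 1 / suc d) (m × (+ 1 / suc d)))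
  (ℚᵘ.≃-trans (ℚᵘ.+-cong (toℚᵘ[1/n] d) (toℚᵘ-×[1/n] m d))
    (ℚᵘ.*≡* (solve 2 (λ m D → (con (+ 1) :* D :+ m :* D) :* D := (con (+ 1) :+ m) :* (D :* D))
                     refl (+ m) (+ suc d))))
  where open ℤ-Solver.+-*-Solver

n×[1/n]≡1 : ∀ d → suc d × (+ 1 / suc d) ≡ 1ℚ
n×[1/n]≡1 d = toℚᵘ-injective (ℚᵘ.≃-trans (toℚᵘ-×[1/n] (suc d) d)
  (ℚᵘ.*≡* (trans (ℤ.*-identityʳ (+ suc d)) (sym (ℤ.*-identityˡ (+ suc d))))))

[1/n]*[n×x]≡x : ∀ k .{{_ : NonZero k}} x → (+ 1 / k) * (k × x) ≡ x
[1/n]*[n×x]≡x (suc d) x = begin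
  (+ 1 / suc d) * (suc d × x)    ≡⟨ ×-comm-* (suc d) (+ 1 / suc d) x ⟩
  suc d × ((+ 1 / suc d) * x)    ≡⟨ ×-assoc-* (suc d) (+ 1 / suc d) x ⟨
  (suc d × (+ 1 / suc d)) * x    ≡⟨ cong (_* x) (n×[1/n]≡1 d) ⟩
  1ℚ * x                         ≡⟨ *-identityˡ x ⟩
  x                              ∎
  where open ≡-Reasoning

average-gain : ∀ k .{{_ : NonZero k}} {a b c g} →
               a + c ≤ (b + c) + k × (g + 1ℚ) → (+ 1 / k) * (a - b) - 1ℚ ≤ g
average-gain k {a} {b} {c} {g} bound = begin
  (+ 1 / k) * (a - b) - 1ℚ          ≤⟨ +-monoˡ-≤ (- 1ℚ) (*-monoˡ-≤-nonNeg (+ 1 / k) {{normalize-nonNeg 1 k}} a-b≤) ⟩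
  (+ 1 / k) * (k × (g + 1ℚ)) - 1ℚ   ≡⟨ cong (_- 1ℚ) ([1/n]*[n×x]≡x k (g + 1ℚ)) ⟩
  (g + 1ℚ) - 1ℚ                     ≡⟨ solve 1 (λ g → (g :+ con 1ℚ) :- con 1ℚ := g) refl g ⟩
  g                                 ∎
  where
  open ≤-Reasoning
  open ℚ-Solver.+-*-Solver
  a-b≤ : a - b ≤ k × (g + 1ℚ)
  a-b≤ = +-cancelʳ-≤ (b + c) (subst₂ _≤_
    (solve 3 (λ a b c → a :+ c := (a :- b) :+ (b :+ c)) refl a b c)
    (+-comm (b + c) (k × (g + 1ℚ))) bound)

sumℚ-tabulate : ∀ {n} (f : Fin n → ℚ) → sumℚ (List.tabulate f) ≡ sum f
sumℚ-tabulate {zero}  f = refl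
sumℚ-tabulate {suc n} f = cong (_+_ (f zero)) (sumℚ-tabulate (f ∘ suc))

sum-mono-≤ : ∀ {n} {f g : Fin n → ℚ} → (∀ i → f i ≤ g i) → sum f ≤ sum g
sum-mono-≤ {zero}  _   = ≤-refl
sum-mono-≤ {suc n} f≤g = +-mono-≤ (f≤g zero) (sum-mono-≤ (f≤g ∘ suc))

indicator : Bool → ℚ
indicator true  = 1ℚ
indicator false = 0ℚ

∑indicator≡∣∣ : ∀ {n} (X : Subset n) → sum (λ v → indicator (lookup X v)) ≡ ∣ X ∣ × 1ℚ
∑indicator≡∣∣ []            = refl
∑indicator≡∣∣ (inside  ∷ X) = cong (_+_ 1ℚ) (∑indicator≡∣∣ X)
∑indicator≡∣∣ (outside ∷ X) = trans (+-identityˡ _) (∑indicator≡∣∣ X)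

-- Submodular set functions

module _ {n : ℕ} (f : Subset n → ℚ)
         (submodular : ∀ S A B → f (S ∪ (A ∪ B)) + f S ≤ f (S ∪ A) + f (S ∪ B)) where

  ∪-⋃-singletons-≤ : ∀ S {M} → (∀ u → f (S ∪ ⁅ u ⁆) ≤ f S + M) →
                     ∀ us → f (S ∪ ⋃ (map ⁅_⁆ us)) ≤ f S + length us × M
  ∪-⋃-singletons-≤ S gain [] =
    ≤-reflexive (trans (cong f (∪-identityʳ S)) (sym (+-identityʳ (f S))))
  ∪-⋃-singletons-≤ S {M} gain (u ∷ us) = +-cancelʳ-≤ (f S) (begin
    f (S ∪ (⁅ u ⁆ ∪ U)) + f S             ≤⟨ submodular S ⁅ u ⁆ U ⟩
    f (S ∪ ⁅ u ⁆) + f (S ∪ U)             ≤⟨ +-mono-≤ (gain u) (∪-⋃-singletons-≤ S gain us) ⟩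
    (f S + M) + (f S + length us × M)     ≡⟨ solve 3 (λ a m t → (a :+ m) :+ (a :+ t) := (a :+ (m :+ t)) :+ a)
                                                   refl (f S) M (length us × M) ⟩
    (f S + (M + length us × M)) + f S     ∎)
    where
    open ≤-Reasoning
    open ℚ-Solver.+-*-Solver
    U = ⋃ (map ⁅_⁆ us)

  submodular-∪-≤ : ∀ S {M} → (∀ u → f (S ∪ ⁅ u ⁆) ≤ f S + M) → ∀ T → f (S ∪ T) ≤ f S + ∣ T ∣ × M
  submodular-∪-≤ S {M} gain T =
    subst₂ (λ X m → f (S ∪ X) ≤ f S + m × M) (⋃-elements T) (length-elements T)
      (∪-⋃-singletons-≤ S gain (elements T))

-- Greedy prefixes

any-∨ : ∀ {a} {A : Set a} (f g : A → Bool) xs → any (λ x → f x ∨ g x) xs ≡ any f xs ∨ any g xs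
any-∨ f g []       = refl
any-∨ f g (x ∷ xs) = trans (cong ((f x ∨ g x) ∨_) (any-∨ f g xs)) (interchange (f x) (g x) (any f xs) (any g xs))

any-false : ∀ {a} {A : Set a} (xs : List A) → any (λ _ → false) xs ≡ false
any-false []       = refl
any-false (x ∷ xs) = any-false xs

any-allFin-suc : ∀ {k} (f : Fin (suc k) → Bool) → any f (allFin (suc k)) ≡ f zero ∨ any (f ∘ suc) (allFin k)
any-allFin-suc f = cong (λ ys → f zero ∨ or ys) (trans (map-tabulate suc f) (sym (map-tabulate id (f ∘ suc))))

module _ {n : ℕ} where

  prefix-zero : ∀ {k} (vs : Fin k → Fin n) → prefix vs 0 ≡ ⊥
  prefix-zero {k} vs = lookup-ext λ v →
    trans (lookup∘tabulate _ v) (trans (any-false (allFin k)) (sym (lookup-replicate v outside)))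

  prefix-suc-cons : ∀ {k} (vs : Fin (suc k) → Fin n) m → prefix vs (suc m) ≡ ⁅ vs zero ⁆ ∪ prefix (vs ∘ suc) m
  prefix-suc-cons vs m = lookup-ext λ v → begin
    lookup (prefix vs (suc m)) v
      ≡⟨ trans (lookup∘tabulate _ v) (any-allFin-suc (λ j → (toℕ j <ᵇ suc m) ∧ ⌊ vs j ≟ v ⌋)) ⟩
    ⌊ vs zero ≟ v ⌋ ∨ any (λ j → (toℕ j <ᵇ m) ∧ ⌊ vs (suc j) ≟ v ⌋) (allFin _)
      ≡⟨ cong₂ _∨_ (lookup-⁅⁆ (vs zero) v) (lookup∘tabulate _ v) ⟨
    lookup ⁅ vs zero ⁆ v ∨ lookup (prefix (vs ∘ suc) m) v
      ≡⟨ lookup-∪ ⁅ vs zero ⁆ (prefix (vs ∘ suc) m) v ⟨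
    lookup (⁅ vs zero ⁆ ∪ prefix (vs ∘ suc) m) v ∎
    where open ≡-Reasoning

  prefix-suc : ∀ {k} (vs : Fin k → Fin n) (i : Fin k) → prefix vs (suc (toℕ i)) ≡ prefix vs (toℕ i) ∪ ⁅ vs i ⁆
  prefix-suc vs zero = begin
    prefix vs 1                        ≡⟨ prefix-suc-cons vs 0 ⟩
    ⁅ vs zero ⁆ ∪ prefix (vs ∘ suc) 0  ≡⟨ cong (⁅ vs zero ⁆ ∪_) (prefix-zero (vs ∘ suc)) ⟩
    ⁅ vs zero ⁆ ∪ ⊥                    ≡⟨ trans (∪-identityʳ _) (sym (∪-identityˡ _)) ⟩
    ⊥ ∪ ⁅ vs zero ⁆                    ≡⟨ cong (_∪ ⁅ vs zero ⁆) (prefix-zero vs) ⟨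
    prefix vs 0 ∪ ⁅ vs zero ⁆          ∎
    where open ≡-Reasoning
  prefix-suc vs (suc i) = begin
    prefix vs (2 ℕ.+ toℕ i)                                     ≡⟨ prefix-suc-cons vs _ ⟩
    ⁅ vs zero ⁆ ∪ prefix (vs ∘ suc) (suc (toℕ i))               ≡⟨ cong (⁅ vs zero ⁆ ∪_) (prefix-suc (vs ∘ suc) i) ⟩
    ⁅ vs zero ⁆ ∪ (prefix (vs ∘ suc) (toℕ i) ∪ ⁅ vs (suc i) ⁆)  ≡⟨ ∪-assoc _ _ _ ⟨
    (⁅ vs zero ⁆ ∪ prefix (vs ∘ suc) (toℕ i)) ∪ ⁅ vs (suc i) ⁆  ≡⟨ cong (_∪ ⁅ vs (suc i) ⁆) (prefix-suc-cons vs (toℕ i)) ⟨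
    prefix vs (suc (toℕ i)) ∪ ⁅ vs (suc i) ⁆                    ∎
    where open ≡-Reasoning

  ∣prefix∣≡ : ∀ {k} (vs : Fin k → Fin n) → (∀ i → vs i ∉ prefix vs (toℕ i)) →
              ∀ m → m ℕ.≤ k → ∣ prefix vs m ∣ ≡ m
  ∣prefix∣≡ vs fresh zero    _   = trans (cong ∣_∣ (prefix-zero vs)) (∣⊥∣≡0 n)
  ∣prefix∣≡ vs fresh (suc m) m<k = begin
    ∣ prefix vs (suc m) ∣            ≡⟨ cong (λ t → ∣ prefix vs (suc t) ∣) j≡m ⟨
    ∣ prefix vs (suc (toℕ j)) ∣      ≡⟨ cong ∣_∣ (prefix-suc vs j) ⟩
    ∣ prefix vs (toℕ j) ∪ ⁅ vs j ⁆ ∣ ≡⟨ x∉p⇒∣p∪⁅x⁆∣≡1+∣p∣ (fresh j) ⟩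
    suc ∣ prefix vs (toℕ j) ∣        ≡⟨ cong (λ t → suc ∣ prefix vs t ∣) j≡m ⟩
    suc ∣ prefix vs m ∣              ≡⟨ cong suc (∣prefix∣≡ vs fresh m (ℕ.<⇒≤ m<k)) ⟩
    suc m                            ∎
    where
    open ≡-Reasoning
    j = fromℕ< m<k
    j≡m : toℕ j ≡ m
    j≡m = toℕ-fromℕ< m<k

-- Closeness and coverage

closeness : Maybe ℕ → ℚ
closeness nothing        = 0ℚ
closeness (just zero)    = 1ℚ
closeness (just (suc d)) = + 1 / suc d

closeness-nonNeg : ∀ r → 0ℚ ≤ closeness r
closeness-nonNeg nothing        = ≤-refl
closeness-nonNeg (just zero)    = nonNegative⁻¹ 1ℚ
closeness-nonNeg (just (suc d)) = nonNegative⁻¹ (+ 1 / suc d) {{normalize-nonNeg 1 (suc d)}}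

closeness-suc : ∀ d → closeness (just (suc d)) ≤ closeness (just d)
closeness-suc zero    = ≤-refl
closeness-suc (suc d) = toℚᵘ-cancel-≤
  (ℚᵘ.≤-respˡ-≃ (ℚᵘ.≃-sym (toℚᵘ[1/n] (suc d))) (ℚᵘ.≤-respʳ-≃ (ℚᵘ.≃-sym (toℚᵘ[1/n] d))
    (ℚᵘ.*≤* (subst₂ ℤ._≤_ (sym (ℤ.*-identityˡ _)) (sym (ℤ.*-identityˡ _)) (ℤ.+≤+ (ℕ.n≤1+n _))))))

closeness-if-∨ : ∀ a b d {r s t} → closeness t ≡ closeness r ⊔ closeness s →
                 closeness r ≤ closeness (just d) → closeness s ≤ closeness (just d) →
                 closeness (if a ∨ b then just d else t)
                   ≡ closeness (if a then just d else r) ⊔ closeness (if b then just d else s)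
closeness-if-∨ true  true  _ _  _   _   = sym (⊔-idem _)
closeness-if-∨ true  false _ _  _   s≤d = sym (p≥q⇒p⊔q≡p s≤d)
closeness-if-∨ false true  _ _  r≤d _   = sym (p≤q⇒p⊔q≡q r≤d)
closeness-if-∨ false false _ t≡ _   _   = t≡

module _ {n : ℕ} (G : Graph n) where

  proximity : Subset n → Fin n → ℚ
  proximity X v = closeness (dist G X v)

  coverage : Subset n → ℚ
  coverage X = sum (proximity X)

  step-∪ : ∀ A B → step G (A ∪ B) ≡ step G A ∪ step G B
  step-∪ A B = lookup-ext λ v → begin
    lookup (step G (A ∪ B)) v                  ≡⟨ lookup∘tabulate _ v ⟩
    lookup (A ∪ B) v ∨ reaches (A ∪ B) v       ≡⟨ cong₂ _∨_ (lookup-∪ A B v) (reaches-∪ v) ⟩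
    (lookup A v ∨ lookup B v) ∨ (reaches A v ∨ reaches B v)
                                               ≡⟨ interchange (lookup A v) (lookup B v) (reaches A v) (reaches B v) ⟩
    (lookup A v ∨ reaches A v) ∨ (lookup B v ∨ reaches B v)
                                               ≡⟨ cong₂ _∨_ (lookup∘tabulate _ v) (lookup∘tabulate _ v) ⟨
    lookup (step G A) v ∨ lookup (step G B) v  ≡⟨ lookup-∪ (step G A) (step G B) v ⟨
    lookup (step G A ∪ step G B) v             ∎
    where
    open ≡-Reasoning
    reaches : Subset n → Fin n → Bool
    reaches X v = any (λ u → lookup X u ∧ G u v) (vertices n)
    reaches-∪ : ∀ v → reaches (A ∪ B) v ≡ reaches A v ∨ reaches B v
    reaches-∪ v = trans
      (cong or (map-cong (λ u → trans (cong (_∧ G u v) (lookup-∪ A B u))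
                                      (∧-distribʳ-∨ (G u v) (lookup A u) (lookup B u))) (vertices n)))
      (any-∨ _ _ (vertices n))

  ball-∪ : ∀ A B d → ball G (A ∪ B) d ≡ ball G A d ∪ ball G B d
  ball-∪ A B zero    = refl
  ball-∪ A B (suc d) = trans (cong (step G) (ball-∪ A B d)) (step-∪ (ball G A d) (ball G B d))

  lookup-ball-∪ : ∀ A B d v → lookup (ball G (A ∪ B) d) v ≡ lookup (ball G A d) v ∨ lookup (ball G B d) v
  lookup-ball-∪ A B d v = trans (cong (λ X → lookup X v) (ball-∪ A B d)) (lookup-∪ (ball G A d) (ball G B d) v)

  search-≤ : ∀ X v d f → closeness (search G X v d f) ≤ closeness (just d)
  search-≤ X v d zero with lookup (ball G X d) v
  ... | true  = ≤-refl
  ... | false = closeness-nonNeg (just d)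
  search-≤ X v d (suc f) with lookup (ball G X d) v
  ... | true  = ≤-refl
  ... | false = ≤-trans (search-≤ X v (suc d) f) (closeness-suc d)

  search-∪ : ∀ A B v d f → closeness (search G (A ∪ B) v d f)
                         ≡ closeness (search G A v d f) ⊔ closeness (search G B v d f)
  search-∪ A B v d zero = trans
    (cong (λ b → closeness (if b then just d else nothing)) (lookup-ball-∪ A B d v))
    (closeness-if-∨ (lookup (ball G A d) v) (lookup (ball G B d) v) d {nothing} {nothing} {nothing}
      (sym (⊔-idem 0ℚ)) (closeness-nonNeg (just d)) (closeness-nonNeg (just d)))
  search-∪ A B v d (suc f) = trans
    (cong (λ b → closeness (if b then just d else search G (A ∪ B) v (suc d) f)) (lookup-ball-∪ A B d v))
    (closeness-if-∨ (lookup (ball G A d) v) (lookup (ball G B d) v) d (search-∪ A B v (suc d) f)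
      (≤-trans (search-≤ A v (suc d) f) (closeness-suc d)) (≤-trans (search-≤ B v (suc d) f) (closeness-suc d)))

  proximity-∪ : ∀ A B v → proximity (A ∪ B) v ≡ proximity A v ⊔ proximity B v
  proximity-∪ A B v = search-∪ A B v 0 n

  search-start : ∀ X v d f → lookup (ball G X d) v ≡ true → search G X v d f ≡ just d
  search-start X v d zero    v∈ rewrite v∈ = refl
  search-start X v d (suc f) v∈ rewrite v∈ = refl

  search-≥ : ∀ X v d f {e} → search G X v d f ≡ just e → d ℕ.≤ e
  search-≥ X v d zero eq with lookup (ball G X d) v
  ... | true  = ℕ.≤-reflexive (just-injective eq)
  ... | false = case eq of λ ()
  search-≥ X v d (suc f) eq with lookup (ball G X d) v
  ... | true  = ℕ.≤-reflexive (just-injective eq)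
  ... | false = ℕ.<⇒≤ (search-≥ X v (suc d) f eq)

  search≡start⇒∈ball : ∀ X v d f → search G X v d f ≡ just d → lookup (ball G X d) v ≡ true
  search≡start⇒∈ball X v d zero eq with lookup (ball G X d) v
  ... | true  = refl
  ... | false = case eq of λ ()
  search≡start⇒∈ball X v d (suc f) eq with lookup (ball G X d) v
  ... | true  = refl
  ... | false = contradiction (search-≥ X v (suc d) f eq) ℕ.1+n≰n

  term+indicator≡proximity : ∀ X v → term G X v + indicator (lookup X v) ≡ proximity X v
  term+indicator≡proximity X v with lookup X v in v∈X | dist G X v in dist≡
  ... | true  | _            = trans (+-identityˡ 1ℚ) (cong closeness (trans (sym (search-start X v 0 n v∈X)) dist≡))
  ... | false | nothing      = +-identityʳ 0ℚ
  ... | false | just zero    = contradiction (trans (sym (search≡start⇒∈ball X v 0 n dist≡)) v∈X) λ ()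
  ... | false | just (suc d) = +-identityʳ _

  coverage≡GH+∣∣ : ∀ X → coverage X ≡ GH G X + ∣ X ∣ × 1ℚ
  coverage≡GH+∣∣ X = begin
    sum (proximity X)                                ≡⟨ sum-cong-≗ (sym ∘ term+indicator≡proximity X) ⟩
    sum (λ v → term G X v + indicator (lookup X v))  ≡⟨ ∑-distrib-+ (term G X) (indicator ∘ lookup X) ⟩
    sum (term G X) + sum (indicator ∘ lookup X)      ≡⟨ cong₂ _+_ (sym GH≡∑term) (∑indicator≡∣∣ X) ⟩
    GH G X + ∣ X ∣ × 1ℚ                               ∎
    where
    open ≡-Reasoning
    GH≡∑term : GH G X ≡ sum (term G X)
    GH≡∑term = trans (cong sumℚ (map-tabulate id (term G X))) (sumℚ-tabulate (term G X))

  coverage-∪ˡ : ∀ X Y → coverage X ≤ coverage (X ∪ Y)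
  coverage-∪ˡ X Y = sum-mono-≤ λ v →
    subst (proximity X v ≤_) (sym (proximity-∪ X Y v)) (p≤p⊔q (proximity X v) (proximity Y v))

  coverage-∪ʳ : ∀ X Y → coverage Y ≤ coverage (X ∪ Y)
  coverage-∪ʳ X Y = sum-mono-≤ λ v →
    subst (proximity Y v ≤_) (sym (proximity-∪ X Y v)) (p≤q⊔p (proximity X v) (proximity Y v))

  coverage-submodular : ∀ S A B → coverage (S ∪ (A ∪ B)) + coverage S ≤ coverage (S ∪ A) + coverage (S ∪ B)
  coverage-submodular S A B = begin
    coverage (S ∪ (A ∪ B)) + coverage S                    ≡⟨ ∑-distrib-+ (proximity (S ∪ (A ∪ B))) (proximity S) ⟨
    sum (λ v → proximity (S ∪ (A ∪ B)) v + proximity S v)  ≤⟨ sum-mono-≤ pointwise ⟩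
    sum (λ v → proximity (S ∪ A) v + proximity (S ∪ B) v)  ≡⟨ ∑-distrib-+ (proximity (S ∪ A)) (proximity (S ∪ B)) ⟩
    coverage (S ∪ A) + coverage (S ∪ B)                    ∎
    where
    open ≤-Reasoning
    pointwise : ∀ v → proximity (S ∪ (A ∪ B)) v + proximity S v ≤ proximity (S ∪ A) v + proximity (S ∪ B) v
    pointwise v = subst₂ _≤_
      (cong (_+ proximity S v) (sym (trans (proximity-∪ S (A ∪ B) v) (cong (proximity S v ⊔_) (proximity-∪ A B v)))))
      (sym (cong₂ _+_ (proximity-∪ S A v) (proximity-∪ S B v)))
      (⊔-submodular (proximity S v) (proximity A v) (proximity B v))

  coverage-∪-fresh : ∀ {S u} → u ∉ S →
                     coverage (S ∪ ⁅ u ⁆) ≡ coverage S + ((GH G (S ∪ ⁅ u ⁆) - GH G S) + 1ℚ)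
  coverage-∪-fresh {S} {u} u∉S = begin
    coverage (S ∪ ⁅ u ⁆)                         ≡⟨ coverage≡GH+∣∣ (S ∪ ⁅ u ⁆) ⟩
    GH G (S ∪ ⁅ u ⁆) + ∣ S ∪ ⁅ u ⁆ ∣ × 1ℚ         ≡⟨ cong (λ m → GH G (S ∪ ⁅ u ⁆) + m × 1ℚ) (x∉p⇒∣p∪⁅x⁆∣≡1+∣p∣ u∉S) ⟩
    GH G (S ∪ ⁅ u ⁆) + (1ℚ + ∣ S ∣ × 1ℚ)          ≡⟨ solve 3 (λ a b c → a :+ (con 1ℚ :+ c) := (b :+ c) :+ ((a :- b) :+ con 1ℚ))
                                                       refl (GH G (S ∪ ⁅ u ⁆)) (GH G S) (∣ S ∣ × 1ℚ) ⟩
    (GH G S + ∣ S ∣ × 1ℚ) + ((GH G (S ∪ ⁅ u ⁆) - GH G S) + 1ℚ)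
                                                 ≡⟨ cong (_+ ((GH G (S ∪ ⁅ u ⁆) - GH G S) + 1ℚ)) (coverage≡GH+∣∣ S) ⟨
    coverage S + ((GH G (S ∪ ⁅ u ⁆) - GH G S) + 1ℚ) ∎
    where
    open ≡-Reasoning
    open ℚ-Solver.+-*-Solver

  coverage-∪-fresh-≤ : ∀ {S u g} → u ∉ S → GH G (S ∪ ⁅ u ⁆) - GH G S ≤ g →
                       coverage (S ∪ ⁅ u ⁆) ≤ coverage S + (g + 1ℚ)
  coverage-∪-fresh-≤ {S} u∉S gain≤g = subst (_≤ _) (sym (coverage-∪-fresh u∉S))
    (+-monoʳ-≤ (coverage S) (+-monoˡ-≤ 1ℚ gain≤g))

  -- The vertex w ∉ S only serves to show g + 1 ≥ 0, which the case u ∈ S needs.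
  marginal-≤ : ∀ {S g} w → w ∉ S → (∀ u → u ∉ S → GH G (S ∪ ⁅ u ⁆) - GH G S ≤ g) →
               ∀ u → coverage (S ∪ ⁅ u ⁆) ≤ coverage S + (g + 1ℚ)
  marginal-≤ {S} {g} w w∉S greedy u with u ∈? S
  ... | no  u∉S = coverage-∪-fresh-≤ u∉S (greedy u u∉S)
  ... | yes u∈S = begin
    coverage (S ∪ ⁅ u ⁆)   ≡⟨ cong coverage (x∈p⇒p∪⁅x⁆≡p u∈S) ⟩
    coverage S             ≤⟨ coverage-∪ˡ S ⁅ w ⁆ ⟩
    coverage (S ∪ ⁅ w ⁆)   ≤⟨ coverage-∪-fresh-≤ w∉S (greedy w w∉S) ⟩
    coverage S + (g + 1ℚ)  ∎
    where open ≤-Reasoning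

lemma3p5 : (n : ℕ) (G : Graph n) → IsUndirected G → NoIsolated G →
  (k : ℕ) .{{_ : NonZero k}} →
  (O : Subset n) → ∣ O ∣ ≡ k →
  (∀ (T : Subset n) → ∣ T ∣ ≡ k → GH G T ≤ GH G O) →
  (vs : Fin k → Fin n) →
  (∀ (i : Fin k) → vs i ∉ prefix vs (toℕ i)) →
  (∀ (i : Fin k) (w : Fin n) → w ∉ prefix vs (toℕ i) →
    GH G (prefix vs (toℕ i) ∪ ⁅ w ⁆) - GH G (prefix vs (toℕ i))
      ≤ GH G (prefix vs (suc (toℕ i))) - GH G (prefix vs (toℕ i))) →
  ∀ (i : Fin k) →
    (+ 1 / k) * (GH G O - GH G (prefix vs (toℕ i))) - 1ℚ
      ≤ GH G (prefix vs (suc (toℕ i))) - GH G (prefix vs (toℕ i))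
lemma3p5 n G _ _ k O ∣O∣≡k _ vs fresh greedy i = average-gain k {GH G O} {GH G S} {k × 1ℚ} (begin
  GH G O + k × 1ℚ               ≡⟨ cong (λ m → GH G O + m × 1ℚ) ∣O∣≡k ⟨
  GH G O + ∣ O ∣ × 1ℚ            ≡⟨ coverage≡GH+∣∣ G O ⟨
  coverage G O                  ≤⟨ coverage-∪ʳ G S O ⟩
  coverage G (S ∪ O)            ≤⟨ submodular-∪-≤ (coverage G) (coverage-submodular G) S
                                     (marginal-≤ G (vs i) (fresh i) (greedy i)) O ⟩
  coverage G S + ∣ O ∣ × M       ≡⟨ cong₂ (λ c m → c + m × M) (coverage≡GH+∣∣ G S) ∣O∣≡k ⟩
  (GH G S + ∣ S ∣ × 1ℚ) + k × M  ≤⟨ +-monoˡ-≤ (k × M) (+-monoʳ-≤ (GH G S) (×-monoˡ-≤ (nonNegative⁻¹ 1ℚ) ∣S∣≤k)) ⟩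
  (GH G S + k × 1ℚ) + k × M      ∎)
  where
  open ≤-Reasoning
  S = prefix vs (toℕ i)
  M = (GH G (prefix vs (suc (toℕ i))) - GH G S) + 1ℚ
  ∣S∣≤k : ∣ S ∣ ℕ.≤ k
  ∣S∣≤k = subst (ℕ._≤ k) (sym (∣prefix∣≡ vs fresh (toℕ i) (toℕ≤n i))) (toℕ≤n i)
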